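{- Let $\Sigma$ be a finite alphabet and $\mathrm{BOS}\notin\Sigma$. (a) Let $T$ be a fixed-precision future-masked soft attention transformer over $\Sigma$ with values in $\mathbb{F}_{r,s}$ and without positional encodings, with $d$ dimensions. Then for every dimension $k\in[1,d]$ and every value $F\in\mathbb{F}_{r,s}$ there is a $\mathsf{K}_{\mathrm{t}}[\#]$ formula $\Phi$ such that for every nonempty $w\in\Sigma^*$ of length $n$ and every $i\in[1,n]$, the entry $[T(\mathrm{BOS}\cdot w)]_{k,i+1}$ equals $F$ if and only if $w,i\vDash\Phi$. (b) The same holds for fixed-precision future-masked soft attention transformers with sinusoidal positional encodings, with $\Phi$ a formula of $\mathsf{K}_{\mathrm{t}}[\#;\mathsf{MOD}]$.
   Context: Strings are $w=w_1\cdots w_n$, $n\ge1$. The logic $\mathsf{K}_{\mathrm{t}}[\#]$: formulas $F ::= Q_a \mid \lnot F \mid F\land F \mid C\le C \mid \top$ ($a\in\Sigma$), count terms $C ::= \#[F] \mid C+C \mid C-C \mid 1$, interpreted at $i\in[1,n]$: $\#[F]^{w,i}=|\{j\in[1,i]: w,j\vDash F\}|$, $\pm$ and $1$ as usual; $w,i\vDash Q_a$ iff $w_i=a$; $\lnot,\land$ as usual; $w,i\vDash C_1\le C_2$ iff $C_1^{w,i}\le C_2^{w,i}$; $\top$ always holds. $\mathsf{K}_{\mathrm{t}}[\#;\mathsf{MOD}]$ additionally has atomic formulas $\mathsf{MOD}^k_m$ (integers $m\ge1$, $0\le k<m$) with $w,i\vDash\mathsf{MOD}^k_m$ iff $i\equiv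 k \pmod m$. Fixed precision: $\mathbb{F}_{r,s}=\{i/2^s : -2^{r+s}\le i<2^{r+s}\}$ (numbers with $r$ integer bits and $s$ fractional bits, two's complement). A fixed-precision future-masked soft attention transformer is defined like the real-valued one below, except that all parameters and all computed values lie in $\mathbb{F}_{r,s}$: every position-wise operation (embedding, feed-forward, LayerNorm, exponentials of attention scores and their products with values) is a function into $\mathbb{F}_{r,s}$, and the attention output at each position and dimension is the element $F\in\mathbb{F}_{r,s}$ with $F\le \frac{\sum_{j\le i}e_{ij}v_j}{\sum_{j\le i}e_{ij}}<F+2^{ -s}$, where $e_{ij}$ are the (fixed-precision) exponentiated scores and $v_j$ the value entries. Real-valued architecture: the input $w$ is processed as $\mathrm{BOS}\cdot w$, column $1$ for $\mathrm{BOS}$ and column $i+1$ for $w_i$; a word embedding $\mathit{WE}:\Sigma\cup\{\mathrm{BOS}\}\to\mathbb{R}^d$ is applied position-wise (plus, in case (b), a sinusoidal positional encoding vector depending on the position); then blocks $B(A)=\mathit{LN}_2(\mathit{FFN}(A')+A')$, $A'=\mathit{LN}_1(\mathit{SA}(A)+A)$ where $\mathit{SA}$ is future-masked softmax attention (scores $s_{ij}=(W^{(Q)}A_{*,i})\cdot(W^{(K)}A_{*,j})/\sqrt d$, output at column $i$ equal to $\sum_{j\le i}\exp(s_{ij})W^{(V)}A_{*,j}/\sum_{j\le i}\exp(s_{ij})$), $\mathit{FFN}$ is a position-wise two-layer ReLU network, and $\mathit{LN}$ is position-wise LayerNorm. Sinusoidal positional encodings are those whose entries are sines/cosines of the position that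 are periodic in the position (so that each entry depends only on the position modulo some fixed integer). -}

module Defs where

open import Data.Bool using (Bool; true; false; _∧_; not)
open import Data.Nat as ℕ using (ℕ; zero; suc; _^_; _%_)
import Data.Nat.Properties as ℕP
open import Data.Integer as ℤ using (ℤ; +_; _-_; _*_; _≤ᵇ_)
import Data.Integer as ℤ
open import Data.Fin as Fin using (Fin; toℕ)
import Data.Fin.Properties as FinP
open import Data.List as List using (List; []; _∷_; allFin; filterᵇ; head; foldl)
open import Data.Vec as Vec using (Vec; []; _∷_; lookup; tabulate)
open import Data.Maybe as Maybe using (Maybe; just; nothing; _>>=_)
open import Relation.Nullary.Decidable using (⌊_⌋)
open import Relation.Binary.PropositionalEquality using (_≡_)

-- An element x : FP r s is (a wrapper around) a code in [0, 2^(r+s+1)); it denotes the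
-- number  val x / 2^s  where  val x = toℕ x - 2^(r+s)  ∈ [-2^(r+s), 2^(r+s)).
-- This is a bijection onto F_{r,s} = { i/2^s : -2^(r+s) ≤ i < 2^(r+s) }.

record FP (r s : ℕ) : Set where
  constructor fp
  field
    code : Fin (2 ^ suc (r ℕ.+ s))
open FP public

val : ∀ {r s} → FP r s → ℤ
val {r} {s} x = + toℕ (code x) - + (2 ^ (r ℕ.+ s))

-- The logics K_t[#] (b = false) and K_t[#;MOD] (b = true) over the
-- alphabet Fin σ.

mutual
  data Formula (σ : ℕ) : Bool → Set where
    Q    : ∀ {b} → Fin σ → Formula σ b
    ¬'_  : ∀ {b} → Formula σ b → Formula σ b
    _∧'_ : ∀ {b} → Formula σ b → Formula σ b → Formula σ b
    _≤'_ : ∀ {b} → Count σ b → Count σ b → Formula σ b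
    ⊤'   : ∀ {b} → Formula σ b
    MOD  : (m : ℕ) → Fin m → Formula σ true

  data Count (σ : ℕ) : Bool → Set where
    #[_] : ∀ {b} → Formula σ b → Count σ b
    _+'_ : ∀ {b} → Count σ b → Count σ b → Count σ b
    _-'_ : ∀ {b} → Count σ b → Count σ b → Count σ b
    one  : ∀ {b} → Count σ b

countUpTo : ∀ {N} → (Fin N → Bool) → Fin N → ℕ
countUpTo {N} p i =
  List.length (filterᵇ (λ j → (toℕ j ℕ.≤ᵇ toℕ i) ∧ p j) (allFin N))

-- Semantics.  A word w of length N is a Vec (Fin σ) N; the 0-based index
-- i : Fin N stands for the position toℕ i + 1 ∈ [1, N].
mutual
  eval : ∀ {σ b N} → Formula σ b → Vec (Fin σ) N → Fin N → Bool
  eval (Q a)      w i = ⌊ lookup w i Fin.≟ a ⌋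
  eval (¬' φ)     w i = not (eval φ w i)
  eval (φ ∧' ψ)   w i = eval φ w i ∧ eval ψ w i
  eval (c ≤' c')  w i = evalC c w i ≤ᵇ evalC c' w i
  eval ⊤'         w i = true
  eval (MOD (suc m) k) w i = ⌊ suc (toℕ i) % suc m ℕ.≟ toℕ k ⌋

  evalC : ∀ {σ b N} → Count σ b → Vec (Fin σ) N → Fin N → ℤ
  evalC #[ φ ]    w i = + countUpTo (λ j → eval φ w j) i
  evalC (c +' c') w i = evalC c w i ℤ.+ evalC c' w i
  evalC (c -' c') w i = evalC c w i - evalC c' w i
  evalC one       w i = + 1

_,_⊨_ : ∀ {σ b N} → Vec (Fin σ) N → Fin N → Formula σ b → Set
w , i ⊨ φ = eval φ w i ≡ true

data Tok (σ : ℕ) : Set where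
  BOS : Tok σ
  sym : Fin σ → Tok σ

-- One block B(A) = LN₂(FFN(A') + A'),  A' = LN₁(SA(A) + A).
-- All position-wise operations are (arbitrary) functions into F_{r,s},
-- as in the fixed-precision model, where their rounding is unspecified.
record Layer (r s d : ℕ) : Set where
  field
    -- fixed-precision attention score s_ij of column i (query side)
    -- and column j (key side): (W^Q A_i)·(W^K A_j)/√d
    score : Vec (FP r s) d → Vec (FP r s) d → FP r s
    expF  : FP r s → FP r s
    value : Vec (FP r s) d → Vec (FP r s) d
    mulF  : FP r s → FP r s → FP r s
    -- A'_i = LN₁(SA(A)_i + A_i), given A_i and SA(A)_i
    post₁ : Vec (FP r s) d → Vec (FP r s) d → Vec (FP r s) d
    -- LN₂(FFN(A'_i) + A'_i), given A'_i
    post₂ : Vec (FP r s) d → Vec (FP r s) d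

-- Rounding of the attention average: the unique F with
--   F ≤ (Σ_j e_ij v_j) / (Σ_j e_ij) < F + 2^-s .
-- With numerators  num = Σ val(e_ij v_j)  and  den = Σ val(e_ij)  this is
--   val F · den² ≤ 2^s · num · den < (val F + 1) · den²
-- (which has no solution when den = 0).  If no F ∈ F_{r,s} satisfies
-- this, the output is undefined (nothing).
isAttOut : ∀ {r s} → ℤ → ℤ → FP r s → Bool
isAttOut {r} {s} num den f =
  (val f * den * den ≤ᵇ + (2 ^ s) * num * den)
  ∧ (+ (2 ^ s) * num * den ℤ.+ + 1 ≤ᵇ (val f ℤ.+ + 1) * den * den)

roundAtt : ∀ {r s} → ℤ → ℤ → Maybe (FP r s)
roundAtt num den = head (filterᵇ (isAttOut num den) (List.map fp (allFin _)))

sumℤ : List ℤ → ℤ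
sumℤ = List.foldr ℤ._+_ (+ 0)

allJust : ∀ {A : Set} → List (Maybe A) → Maybe (List A)
allJust []       = just []
allJust (m ∷ ms) = m >>= λ x → allJust ms >>= λ xs → just (x ∷ xs)

allJustVec : ∀ {A : Set} {k} → Vec (Maybe A) k → Maybe (Vec A k)
allJustVec []       = just []
allJustVec (m ∷ ms) = m >>= λ x → allJustVec ms >>= λ xs → just (x ∷ xs)

-- attention output at a column with content a, given the columns
-- bs = (A_j)_{j ≤ i}
attend : ∀ {r s d} → Layer r s d → Vec (FP r s) d → List (Vec (FP r s) d)
       → Maybe (Vec (FP r s) d)
attend {r} {s} {d} ℓ a bs =
  allJustVec (tabulate λ k →
    roundAtt (sumℤ (List.map (λ b → val (mulF (e b) (lookup (value b) k))) bs))
             (sumℤ (List.map (λ b → val (e b)) bs)))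
  where
    open Layer ℓ
    e : Vec (FP r s) d → FP r s
    e b = expF (score a b)

Columns : ℕ → ℕ → ℕ → ℕ → Set
Columns r s d L = Fin L → Maybe (Vec (FP r s) d)

applyLayer : ∀ {r s d L} → Layer r s d → Columns r s d L → Columns r s d L
applyLayer {L = L} ℓ A i =
  allJust (List.map A (filterᵇ (λ j → toℕ j ℕ.≤ᵇ toℕ i) (allFin L))) >>= λ bs →
  A i >>= λ a →
  attend ℓ a bs >>= λ sa →
  just (Layer.post₂ ℓ (Layer.post₁ ℓ a sa))

runLayers : ∀ {r s d L} → List (Layer r s d) → Columns r s d L → Columns r s d L
runLayers ls A = foldl (λ B ℓ → applyLayer ℓ B) A ls

bosInput : ∀ {σ n} → Vec (Fin σ) n → Vec (Tok σ) (suc n)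
bosInput w = BOS ∷ Vec.map sym w

record Transformer (σ r s d : ℕ) : Set where
  field
    WE     : Tok σ → Vec (FP r s) d
    layers : List (Layer r s d)

-- T(BOS·w) as columns (0-based column index)
runT : ∀ {σ r s d n} → Transformer σ r s d → Vec (Fin σ) n
     → Columns r s d (suc n)
runT T w j = runLayers (Transformer.layers T)
               (λ j' → just (Transformer.WE T (lookup (bosInput w) j'))) j

-- (b) transformer with (fixed-precision) sinusoidal positional encoding:
-- pe c is the encoding of the (1-based) column c; it is periodic in c.
record TransformerPE (σ r s d : ℕ) : Set where
  field
    WE       : Tok σ → Vec (FP r s) d
    pe       : ℕ → Vec (FP r s) d
    period   : ℕ
    period≥1 : 1 ℕ.≤ period
    periodic : ∀ c → pe (period ℕ.+ c) ≡ pe c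
    addPE    : Vec (FP r s) d → Vec (FP r s) d → Vec (FP r s) d
    layers   : List (Layer r s d)

runTPE : ∀ {σ r s d n} → TransformerPE σ r s d → Vec (Fin σ) n
       → Columns r s d (suc n)
runTPE T w j = runLayers (TransformerPE.layers T)
                 (λ j' → just (TransformerPE.addPE T
                                 (TransformerPE.WE T (lookup (bosInput w) j'))
                                 (TransformerPE.pe T (suc (toℕ j'))))) j

-- entry [T(BOS·w)]_{k, i+1} for a 0-based index i of w (column Fin.suc i)
entry : ∀ {σ r s d n} → Transformer σ r s d → Vec (Fin σ) n → Fin d → Fin n
      → Maybe (FP r s)
entry T w k i = Maybe.map (λ col → lookup col k) (runT T w (Fin.suc i))

entryPE : ∀ {σ r s d n} → TransformerPE σ r s d → Vec (Fin σ) n → Fin d → Fin n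
        → Maybe (FP r s)
entryPE T w k i = Maybe.map (λ col → lookup col k) (runTPE T w (Fin.suc i))

{-# OPTIONS --safe #-}

-- By induction over the layers, every column entry at position i is a function of the truth
-- values at i of finitely many formulas; this works because fixed-precision values range over
-- a finite set, so case distinctions on them are finite. The BOS column only attends to itself
-- and is therefore the same for every word. The attention numerator and denominator at i are
-- sums over j ≤ i of integer-valued definable quantities, and splitting such a sum over the
-- finitely many truth-value patterns of the formulas turns it into a linear combination of
-- counting terms #[φ]. The rounded quotient is then fixed by the signs of these terms and
-- finitely many linear comparisons between them, i.e. by formulas C ≤ C'. Periodic positional
-- encodings only depend on the position modulo the period, which MOD formulas express.

module Submission where

open import Defs
open import Data.Bool using (Bool; true; false; _∧_; _∨_; not; if_then_else_; T)
open import Data.Bool.Properties using (T-≡; ⇔→≡; ∨-identityʳ)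
open import Data.Nat as ℕ using (ℕ; zero; suc; _^_; _%_; NonZero)
open import Data.Nat.DivMod using (_mod_; m≡m%n+[m/n]*n)
import Data.Nat.Properties as ℕP
open import Data.Integer as ℤ using (ℤ; +_; -[1+_]; +[1+_]; 0ℤ; 1ℤ; -1ℤ; _+_; _*_; _≤_; _<_; _≤ᵇ_)
import Data.Integer.Properties as ℤP
open import Algebra.Properties.CommutativeSemigroup ℤP.+-commutativeSemigroup using (interchange)
open import Data.Fin as Fin using (Fin; toℕ; combine; remQuot)
import Data.Fin.Properties as FinP
open import Data.List as List using (List; []; _∷_; filterᵇ; allFin; length)
open import Data.Bool.ListAction using (any)
import Data.List.Properties as ListP
import Data.List.Relation.Unary.All as All
open import Data.Vec as Vec using (Vec; []; _∷_; _++_; lookup; tabulate)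
import Data.Vec.Properties as VecP
open import Data.Maybe as Maybe using (Maybe; just; nothing; _>>=_; is-nothing; fromMaybe)
import Data.Maybe.Properties as MaybeP
open import Data.Product using (_×_; ∃; _,_; proj₁; proj₂)
open import Function using (_∘_; id)
open import Function.Bundles using (_⇔_; mk⇔; Equivalence)
open import Relation.Binary.PropositionalEquality as ≡ using (_≡_; refl; trans; cong; cong₂; module ≡-Reasoning)
open import Relation.Nullary.Decidable using (does; isYes≗does; does-⇔; dec-true; toWitness; map′; T?)
open import Relation.Binary.Definitions using (DecidableEquality)

private
  variable
    A B C : Set

indicator : Bool → ℤ
indicator b = if b then 1ℤ else 0ℤ

filterᵇ-map : ∀ {p : B → Bool} {q : A → Bool} (f : A → B) →
              (∀ x → p (f x) ≡ q x) → ∀ xs → filterᵇ p (List.map f xs) ≡ List.map f (filterᵇ q xs)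
filterᵇ-map f p∘f≗q [] = refl
filterᵇ-map {p = p} {q} f p∘f≗q (x ∷ xs) with p (f x) | q x | p∘f≗q x
... | true  | true  | refl = cong (f x ∷_) (filterᵇ-map f p∘f≗q xs)
... | false | false | refl = filterᵇ-map f p∘f≗q xs

filterᵇ-∧ : ∀ (p q : A → Bool) xs → filterᵇ (λ x → p x ∧ q x) xs ≡ filterᵇ q (filterᵇ p xs)
filterᵇ-∧ p q [] = refl
filterᵇ-∧ p q (x ∷ xs) with p x
... | false = filterᵇ-∧ p q xs
... | true with q x
...   | true  = cong (x ∷_) (filterᵇ-∧ p q xs)
...   | false = filterᵇ-∧ p q xs

length-filterᵇ : ∀ (p : A → Bool) xs → + length (filterᵇ p xs) ≡ sumℤ (List.map (indicator ∘ p) xs)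
length-filterᵇ p [] = refl
length-filterᵇ p (x ∷ xs) with p x
... | true  = cong (_+_ 1ℤ) (length-filterᵇ p xs)
... | false = trans (length-filterᵇ p xs) (≡.sym (ℤP.+-identityˡ _))

any-length-filterᵇ : ∀ (p : A → Bool) xs → any p xs ≡ (1 ℕ.≤ᵇ length (filterᵇ p xs))
any-length-filterᵇ p [] = refl
any-length-filterᵇ p (x ∷ xs) with p x
... | true  = refl
... | false = any-length-filterᵇ p xs

any-≤ᵇ-sum : ∀ (p : A → Bool) xs → any p xs ≡ (1ℤ ≤ᵇ sumℤ (List.map (indicator ∘ p) xs))
any-≤ᵇ-sum p xs = trans (any-length-filterᵇ p xs) (cong (1ℤ ≤ᵇ_) (length-filterᵇ p xs))

allJust-any : ∀ (x : A) ms →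
              allJust ms ≡ (if any is-nothing ms then nothing else just (List.map (fromMaybe x) ms))
allJust-any x [] = refl
allJust-any x (nothing ∷ ms) = refl
allJust-any x (just y ∷ ms) rewrite allJust-any x ms with any is-nothing ms
... | true  = refl
... | false = refl

head-filterᵇ-∷ : ∀ (p : A → Bool) x xs →
                 List.head (filterᵇ p (x ∷ xs)) ≡ (if p x then just x else List.head (filterᵇ p xs))
head-filterᵇ-∷ p x xs with p x
... | true  = refl
... | false = refl

sumℤ-map-+ : ∀ (f g : A → ℤ) xs →
             sumℤ (List.map (λ x → f x + g x) xs) ≡ sumℤ (List.map f xs) + sumℤ (List.map g xs)
sumℤ-map-+ f g [] = refl
sumℤ-map-+ f g (x ∷ xs) = trans (cong (_+_ (f x + g x)) (sumℤ-map-+ f g xs)) (interchange (f x) (g x) _ _)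

sumℤ-map-* : ∀ z (f : A → ℤ) xs → sumℤ (List.map (λ x → z * f x) xs) ≡ z * sumℤ (List.map f xs)
sumℤ-map-* z f [] = ≡.sym (ℤP.*-zeroʳ z)
sumℤ-map-* z f (x ∷ xs) =
  trans (cong (_+_ (z * f x)) (sumℤ-map-* z f xs)) (≡.sym (ℤP.*-distribˡ-+ z (f x) _))

sumℤ-map-∘ : ∀ (g : B → ℤ) (f : A → B) xs → sumℤ (List.map g (List.map f xs)) ≡ sumℤ (List.map (g ∘ f) xs)
sumℤ-map-∘ g f xs = cong sumℤ (≡.sym (ListP.map-∘ xs))

*-indicator : ∀ z x → z * indicator x ≡ (if x then z else 0ℤ)
*-indicator z true  = ℤP.*-identityʳ z
*-indicator z false = ℤP.*-zeroʳ z

if-∧-split : ∀ x y (f : Bool → ℤ) →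
             (if x ∧ y then f true else 0ℤ) + (if x ∧ not y then f false else 0ℤ) ≡ (if x then f y else 0ℤ)
if-∧-split true  true  f = ℤP.+-identityʳ (f true)
if-∧-split true  false f = ℤP.+-identityˡ (f false)
if-∧-split false y     f = refl

take-++ : ∀ {m n} (xs : Vec A m) (ys : Vec A n) → Vec.take m (xs ++ ys) ≡ xs
take-++ []       ys = refl
take-++ (x ∷ xs) ys = cong (x ∷_) (take-++ xs ys)

drop-++ : ∀ {m n} (xs : Vec A m) (ys : Vec A n) → Vec.drop m (xs ++ ys) ≡ ys
drop-++ []       ys = refl
drop-++ (x ∷ xs) ys = drop-++ xs ys

firstTrue : ∀ {k} → Vec Bool k → Maybe (Fin k)
firstTrue []          = nothing
firstTrue (true  ∷ v) = just Fin.zero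
firstTrue (false ∷ v) = Maybe.map Fin.suc (firstTrue v)

firstTrue-≟ : ∀ {k} (x : Fin k) → firstTrue (tabulate (λ a → does (x FinP.≟ a))) ≡ just x
firstTrue-≟ Fin.zero    = refl
firstTrue-≟ (Fin.suc x) = cong (Maybe.map Fin.suc) (firstTrue-≟ x)

prefix : ∀ {N} → Fin N → List (Fin N)
prefix {N} i = filterᵇ (λ j → toℕ j ℕ.≤ᵇ toℕ i) (allFin N)

prefixSum : ∀ {N} → (Fin N → ℤ) → Fin N → ℤ
prefixSum f i = sumℤ (List.map f (prefix i))

prefixSum-cong : ∀ {N} {f g : Fin N → ℤ} → (∀ j → f j ≡ g j) → ∀ i → prefixSum f i ≡ prefixSum g i
prefixSum-cong f≗g i = cong sumℤ (ListP.map-cong f≗g (prefix i))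

countUpTo-prefixSum : ∀ {N} (p : Fin N → Bool) i → + countUpTo p i ≡ prefixSum (indicator ∘ p) i
countUpTo-prefixSum {N} p i =
  trans (cong (+_ ∘ length) (filterᵇ-∧ (λ j → toℕ j ℕ.≤ᵇ toℕ i) p (allFin N)))
        (length-filterᵇ p (prefix i))

<ᵇ-suc : ∀ m n → (m ℕ.<ᵇ suc n) ≡ (m ℕ.≤ᵇ n)
<ᵇ-suc zero    n = refl
<ᵇ-suc (suc m) n = refl

prefix-zero : ∀ {N} → prefix {suc N} Fin.zero ≡ Fin.zero ∷ []
prefix-zero {N} = cong (Fin.zero ∷_) (begin
  filterᵇ _ (List.tabulate Fin.suc)                    ≡⟨ cong (filterᵇ _) (≡.sym (ListP.map-tabulate id Fin.suc)) ⟩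
  filterᵇ _ (List.map Fin.suc (allFin N))              ≡⟨ filterᵇ-map Fin.suc (λ _ → refl) (allFin N) ⟩
  List.map Fin.suc (filterᵇ (λ _ → false) (allFin N))  ≡⟨ cong (List.map Fin.suc) none-pass ⟩
  []                                                   ∎)
  where
    open ≡-Reasoning
    none-pass : filterᵇ (λ _ → false) (allFin N) ≡ []
    none-pass = ListP.filter-none (T? ∘ λ _ → false) (All.universal (λ _ ()) (allFin N))

prefix-suc : ∀ {N} (i : Fin N) → prefix (Fin.suc i) ≡ Fin.zero ∷ List.map Fin.suc (prefix i)
prefix-suc {N} i = cong (Fin.zero ∷_) (begin
  filterᵇ _ (List.tabulate Fin.suc)        ≡⟨ cong (filterᵇ _) (≡.sym (ListP.map-tabulate id Fin.suc)) ⟩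
  filterᵇ _ (List.map Fin.suc (allFin N))  ≡⟨ filterᵇ-map Fin.suc (λ j → <ᵇ-suc (toℕ j) (toℕ i)) (allFin N) ⟩
  List.map Fin.suc (prefix i)              ∎)
  where open ≡-Reasoning

record Finite (A : Set) : Set where
  field
    size          : ℕ
    index         : A → Fin size
    element       : Fin size → A
    element-index : ∀ x → element (index x) ≡ x

open Finite

FP-finite : ∀ {r s} → Finite (FP r s)
FP-finite = record { index = code ; element = fp ; element-index = λ _ → refl }

_≟FP_ : ∀ {r s} → DecidableEquality (FP r s)
x ≟FP y = map′ (cong fp) (cong code) (code x FinP.≟ code y)

Maybe-finite : Finite A → Finite (Maybe A)
Maybe-finite F = record
  { size = suc (size F)
  ; index = Maybe.maybe (Fin.suc ∘ index F) Fin.zero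
  ; element = λ { Fin.zero → nothing ; (Fin.suc t) → just (element F t) }
  ; element-index = λ { nothing → refl ; (just x) → cong just (element-index F x) }
  }

Vec-finite : Finite A → ∀ d → Finite (Vec A d)
Vec-finite F zero =
  record { size = 1 ; index = λ _ → Fin.zero ; element = λ _ → [] ; element-index = λ { [] → refl } }
Vec-finite F (suc d) = record
  { size = size F ℕ.* size V
  ; index = λ { (x ∷ xs) → combine (index F x) (index V xs) }
  ; element = λ t → let (u , v) = remQuot (size V) t in element F u ∷ element V v
  ; element-index = λ { (x ∷ xs) → let rc = FinP.remQuot-combine (index F x) (index V xs) in
      cong₂ _∷_ (trans (cong (element F ∘ proj₁) rc) (element-index F x))
                (trans (cong (element V ∘ proj₂) rc) (element-index V xs)) }
  }
  where V = Vec-finite F d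

≤ᵇ-cong : ∀ {i j k l} → (i ≤ j → k ≤ l) → (k ≤ l → i ≤ j) → (i ≤ᵇ j) ≡ (k ≤ᵇ l)
≤ᵇ-cong f g = ⇔→≡ {z = true} (mk⇔ (transport f) (transport g))
  where
    transport : ∀ {i j k l} → (i ≤ j → k ≤ l) → (i ≤ᵇ j) ≡ true → (k ≤ᵇ l) ≡ true
    transport h = Equivalence.to T-≡ ∘ ℤP.≤⇒≤ᵇ ∘ h ∘ ℤP.≤ᵇ⇒≤ ∘ Equivalence.from T-≡

+1≤⇒< : ∀ {i j} → i + 1ℤ ≤ j → i < j
+1≤⇒< {i} p = ℤP.suc[i]≤j⇒i<j (≡.subst (_≤ _) (ℤP.+-comm i 1ℤ) p)

<⇒+1≤ : ∀ {i j} → i < j → i + 1ℤ ≤ j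
<⇒+1≤ {i} p = ≡.subst (_≤ _) (ℤP.+-comm 1ℤ i) (ℤP.i<j⇒suc[i]≤j p)

<ᵇ-cong : ∀ {i j k l} → (i < j → k < l) → (k < l → i < j) → (i + 1ℤ ≤ᵇ j) ≡ (k + 1ℤ ≤ᵇ l)
<ᵇ-cong f g = ≤ᵇ-cong (<⇒+1≤ ∘ f ∘ +1≤⇒<) (<⇒+1≤ ∘ g ∘ +1≤⇒<)

-- For den > 0 this says val f ≤ 2^s num / den < val f + 1; for den < 0 both
-- inequalities flip, and for den = 0 the condition fails.
linearAttOut : ∀ {r s} → ℤ → ℤ → FP r s → Bool
linearAttOut {s = s} num den f =
  ((1ℤ ≤ᵇ den) ∧ (lo ≤ᵇ m) ∧ (m + 1ℤ ≤ᵇ hi)) ∨ ((den ≤ᵇ -1ℤ) ∧ (m ≤ᵇ lo) ∧ (hi + 1ℤ ≤ᵇ m))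
  where
    m  = + (2 ^ s) * num
    lo = val f * den
    hi = (val f + 1ℤ) * den

isAttOut≡linearAttOut : ∀ {r s} num den (f : FP r s) → isAttOut num den f ≡ linearAttOut num den f
isAttOut≡linearAttOut {s = s} num (+ 0) f
  rewrite ℤP.*-zeroʳ (val f) | ℤP.*-zeroʳ (+ (2 ^ s) * num) | ℤP.*-zeroʳ (val f + 1ℤ) = refl
isAttOut≡linearAttOut {s = s} num d@(+[1+ n ]) f = trans
  (cong₂ _∧_ (≤ᵇ-cong (ℤP.*-cancelʳ-≤-pos (val f * d) (+ (2 ^ s) * num) d) (ℤP.*-monoʳ-≤-nonNeg d))
             (<ᵇ-cong {k = + (2 ^ s) * num} {l = (val f + 1ℤ) * d} (ℤP.*-cancelʳ-<-nonNeg d) (ℤP.*-monoʳ-<-pos d)))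
  (≡.sym (∨-identityʳ _))
isAttOut≡linearAttOut {s = s} num d@(-[1+ n ]) f =
  cong₂ _∧_ (≤ᵇ-cong (ℤP.*-cancelʳ-≤-neg (val f * d) (+ (2 ^ s) * num) d) (ℤP.*-monoʳ-≤-nonPos d))
            (<ᵇ-cong {k = (val f + 1ℤ) * d} {l = + (2 ^ s) * num} (ℤP.*-cancelʳ-<-nonPos d) (ℤP.*-monoʳ-<-neg d))

-- Definable families

module Definability (σ : ℕ) (b : Bool) where

  Fam : Set → Set
  Fam A = ∀ {N} → Vec (Fin σ) N → Fin N → A

  truths : ∀ {m N} → Vec (Formula σ b) m → Vec (Fin σ) N → Fin N → Vec Bool m
  truths φs w i = Vec.map (λ φ → eval φ w i) φs

  record Definable (X : Fam A) : Set where
    field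
      {arity}       : ℕ
      atoms         : Vec (Formula σ b) arity
      decode        : Vec Bool arity → A
      decode-truths : ∀ {N} (w : Vec (Fin σ) N) i → X w i ≡ decode (truths atoms w i)

  open Definable

  Expressible : Fam Bool → Set
  Expressible p = ∃ λ (Φ : Formula σ b) → ∀ {N} (w : Vec (Fin σ) N) i → eval Φ w i ≡ p w i

  CountExpressible : Fam ℤ → Set
  CountExpressible t = ∃ λ (c : Count σ b) → ∀ {N} (w : Vec (Fin σ) N) i → evalC c w i ≡ t w i

  Definable-resp : {X Y : Fam A} → (∀ {N} (w : Vec (Fin σ) N) i → X w i ≡ Y w i) → Definable X → Definable Y
  Definable-resp X≗Y D = record
    { atoms = atoms D ; decode = decode D
    ; decode-truths = λ w i → trans (≡.sym (X≗Y w i)) (decode-truths D w i) }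

  const-definable : (x : A) → Definable (λ _ _ → x)
  const-definable x = record { atoms = [] ; decode = λ _ → x ; decode-truths = λ _ _ → refl }

  formula-definable : (φ : Formula σ b) → Definable (eval φ)
  formula-definable φ = record { atoms = φ ∷ [] ; decode = Vec.head ; decode-truths = λ _ _ → refl }

  map-definable : (f : A → B) {X : Fam A} → Definable X → Definable (λ w i → f (X w i))
  map-definable f D = record
    { atoms = atoms D ; decode = f ∘ decode D
    ; decode-truths = λ w i → cong f (decode-truths D w i) }

  zipWith-definable : (f : A → B → C) {X : Fam A} {Y : Fam B} →
                      Definable X → Definable Y → Definable (λ w i → f (X w i) (Y w i))
  zipWith-definable f DX DY = record
    { atoms = atoms DX ++ atoms DY
    ; decode = λ v → f (decode DX (Vec.take _ v)) (decode DY (Vec.drop _ v))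
    ; decode-truths = λ w i →
        let u = truths (atoms DX) w i ; v = truths (atoms DY) w i in begin
        _  ≡⟨ cong₂ f (decode-truths DX w i) (decode-truths DY w i) ⟩
        f (decode DX u) (decode DY v)
           ≡⟨ cong₂ (λ u′ v′ → f (decode DX u′) (decode DY v′)) (take-++ u v) (drop-++ u v) ⟨
        f (decode DX (Vec.take _ (u ++ v))) (decode DY (Vec.drop _ (u ++ v)))
           ≡⟨ cong (λ uv → f (decode DX (Vec.take _ uv)) (decode DY (Vec.drop _ uv)))
                   (VecP.map-++ (λ φ → eval φ w i) (atoms DX) (atoms DY)) ⟨
        _ ∎ }
    where open ≡-Reasoning

  tabulate-definable : ∀ {k} {X : Fin k → Fam A} → (∀ t → Definable (X t)) →
                       Definable (λ w i → tabulate (λ t → X t w i))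
  tabulate-definable {k = zero}  D = const-definable []
  tabulate-definable {k = suc k} D = zipWith-definable _∷_ (D Fin.zero) (tabulate-definable (D ∘ Fin.suc))

  -- Tabulate all branches, then select one.
  case-definable : (F : Finite A) {X : Fam A} {Y : A → Fam B} →
                   Definable X → (∀ x → Definable (Y x)) → Definable (λ w i → Y (X w i) w i)
  case-definable F {X} {Y} DX DY = Definable-resp
    (λ w i → trans (VecP.lookup∘tabulate _ (index F (X w i))) (cong (λ x → Y x w i) (element-index F (X w i))))
    (zipWith-definable (λ x ys → lookup ys (index F x)) DX (tabulate-definable (DY ∘ element F)))

  if-definable : {p : Fam Bool} {X Y : Fam A} → Definable p → Definable X → Definable Y →
                 Definable (λ w i → if p w i then X w i else Y w i)
  if-definable Dp DX DY =
    zipWith-definable (λ c xy → if c then proj₁ xy else proj₂ xy) Dp (zipWith-definable _,_ DX DY)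

  head-filterᵇ-definable : (xs : List A) {P : A → Fam Bool} → (∀ x → Definable (P x)) →
                           Definable (λ w i → List.head (filterᵇ (λ x → P x w i) xs))
  head-filterᵇ-definable []       DP = const-definable nothing
  head-filterᵇ-definable (x ∷ xs) {P} DP =
    Definable-resp (λ w i → ≡.sym (head-filterᵇ-∷ (λ y → P y w i) x xs))
                   (if-definable (DP x) (const-definable (just x)) (head-filterᵇ-definable xs DP))

  ite : Formula σ b → Formula σ b → Formula σ b → Formula σ b
  ite φ ψ χ = (¬' (φ ∧' (¬' ψ))) ∧' (¬' ((¬' φ) ∧' (¬' χ)))

  eval-ite : ∀ {N} φ ψ χ (w : Vec (Fin σ) N) i →
             eval (ite φ ψ χ) w i ≡ (if eval φ w i then eval ψ w i else eval χ w i)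
  eval-ite φ ψ χ w i = ite-bool (eval φ w i) (eval ψ w i) (eval χ w i)
    where
      ite-bool : ∀ x y z → not (x ∧ not y) ∧ not (not x ∧ not z) ≡ (if x then y else z)
      ite-bool true  true  z     = refl
      ite-bool true  false z     = refl
      ite-bool false y     true  = refl
      ite-bool false y     false = refl

  truthTable-expressible : ∀ {m} (h : Vec Bool m → Bool) (φs : Vec (Formula σ b) m) →
                           Expressible (λ w i → h (truths φs w i))
  truthTable-expressible h [] with h []
  ... | true  = ⊤' , λ _ _ → refl
  ... | false = ¬' ⊤' , λ _ _ → refl
  truthTable-expressible h (φ ∷ φs) = ite φ Φ₁ Φ₀ , λ w i → trans (eval-ite φ Φ₁ Φ₀ w i) (by-cases w i)
    where
      Φ₁ = proj₁ (truthTable-expressible (h ∘ (true ∷_)) φs)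
      Φ₀ = proj₁ (truthTable-expressible (h ∘ (false ∷_)) φs)
      by-cases : ∀ {N} (w : Vec (Fin σ) N) i →
                 (if eval φ w i then eval Φ₁ w i else eval Φ₀ w i) ≡ h (eval φ w i ∷ truths φs w i)
      by-cases w i with eval φ w i
      ... | true  = proj₂ (truthTable-expressible (h ∘ (true ∷_)) φs) w i
      ... | false = proj₂ (truthTable-expressible (h ∘ (false ∷_)) φs) w i

  definable⇒expressible : {X : Fam A} → Definable X → (p : A → Bool) → Expressible (λ w i → p (X w i))
  definable⇒expressible D p =
    let Φ , eval-Φ = truthTable-expressible (p ∘ decode D) (atoms D) in
    Φ , λ w i → trans (eval-Φ w i) (cong p (≡.sym (decode-truths D w i)))

  partition-definable : ∀ {k} (φ : Fin k → Formula σ b) {X : Fam (Fin k)} →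
                        (∀ {N} (w : Vec (Fin σ) N) i a → eval (φ a) w i ≡ does (X w i FinP.≟ a)) →
                        Definable (λ w i → just (X w i))
  partition-definable φ {X} φ≗ = record
    { atoms = tabulate φ ; decode = firstTrue
    ; decode-truths = λ w i → ≡.sym (begin
        firstTrue (Vec.map (λ ψ → eval ψ w i) (tabulate φ))  ≡⟨ cong firstTrue (VecP.tabulate-∘ _ φ) ⟨
        firstTrue (tabulate (λ a → eval (φ a) w i))          ≡⟨ cong firstTrue (VecP.tabulate-cong (φ≗ w i)) ⟩
        firstTrue (tabulate (λ a → does (X w i FinP.≟ a)))   ≡⟨ firstTrue-≟ (X w i) ⟩
        just (X w i)                                         ∎) }
    where open ≡-Reasoning

  level-set-expressible : DecidableEquality A → {X : Fam A} → Definable X → (x : A) →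
    ∃ λ (Φ : Formula σ b) → ∀ {N} (w : Vec (Fin σ) N) i → (X w i ≡ x) ⇔ (w , i ⊨ Φ)
  level-set-expressible _≟_ {X} D x =
    let Φ , eval-Φ = definable⇒expressible D (λ y → does (y ≟ x)) in
    Φ , λ w i → mk⇔ (λ X≡x → trans (eval-Φ w i) (dec-true (X w i ≟ x) X≡x))
                    (λ ⊨Φ → toWitness {a? = X w i ≟ x} (≡.subst T (≡.sym (isYes≗does (X w i ≟ x)))
                                        (Equivalence.from T-≡ (trans (≡.sym (eval-Φ w i)) ⊨Φ))))

  letter-definable : Definable (λ w i → just (lookup w i))
  letter-definable = partition-definable Q (λ w i a → isYes≗does (lookup w i FinP.≟ a))

  _·_ : ℕ → Count σ b → Count σ b
  zero  · c = one -' one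
  suc n · c = c +' (n · c)

  scale : ℤ → Count σ b → Count σ b
  scale (+ n)    c = n · c
  scale -[1+ n ] c = (one -' one) -' (suc n · c)

  evalC-· : ∀ {N} n c (w : Vec (Fin σ) N) i → evalC (n · c) w i ≡ + n * evalC c w i
  evalC-· zero    c w i = refl
  evalC-· (suc n) c w i = trans (cong (_+_ (evalC c w i)) (evalC-· n c w i)) (≡.sym (ℤP.suc-* (+ n) _))

  evalC-scale : ∀ {N} z c (w : Vec (Fin σ) N) i → evalC (scale z c) w i ≡ z * evalC c w i
  evalC-scale (+ n)    c w i = evalC-· n c w i
  evalC-scale -[1+ n ] c w i =
    trans (ℤP.+-identityˡ _) (trans (cong ℤ.-_ (evalC-· (suc n) c w i)) (ℤP.neg-distribˡ-* (+ suc n) _))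

  CountExpressible-resp : {t u : Fam ℤ} → (∀ {N} (w : Vec (Fin σ) N) i → t w i ≡ u w i) →
                          CountExpressible t → CountExpressible u
  CountExpressible-resp t≗u (c , eval-c) = c , λ w i → trans (eval-c w i) (t≗u w i)

  const-expressible : ∀ z → CountExpressible (λ _ _ → z)
  const-expressible z = scale z one , λ w i → trans (evalC-scale z one w i) (ℤP.*-identityʳ z)

  +-expressible : {t u : Fam ℤ} → CountExpressible t → CountExpressible u →
                  CountExpressible (λ w i → t w i + u w i)
  +-expressible (c , eval-c) (c′ , eval-c′) = c +' c′ , λ w i → cong₂ _+_ (eval-c w i) (eval-c′ w i)

  *-expressible : ∀ z {t : Fam ℤ} → CountExpressible t → CountExpressible (λ w i → z * t w i)
  *-expressible z (c , eval-c) = scale z c , λ w i → trans (evalC-scale z c w i) (cong (z *_) (eval-c w i))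

  ≤ᵇ-definable : {t u : Fam ℤ} → CountExpressible t → CountExpressible u →
                 Definable (λ w i → t w i ≤ᵇ u w i)
  ≤ᵇ-definable (c , eval-c) (c′ , eval-c′) =
    Definable-resp (λ w i → cong₂ _≤ᵇ_ (eval-c w i) (eval-c′ w i)) (formula-definable (c ≤' c′))

  -- Expand g on its first argument; the guard ψ records the truth values fixed so far.
  guardedSum-expressible : ∀ {m} (ψ : Formula σ b) (φs : Vec (Formula σ b) m) (g : Vec Bool m → ℤ) →
    CountExpressible (λ w i → prefixSum (λ j → if eval ψ w j then g (truths φs w j) else 0ℤ) i)
  guardedSum-expressible ψ [] g = scale (g []) #[ ψ ] , λ w i → begin
    evalC (scale (g []) #[ ψ ]) w i                    ≡⟨ evalC-scale (g []) #[ ψ ] w i ⟩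
    g [] * + countUpTo (eval ψ w) i                    ≡⟨ cong (g [] *_) (countUpTo-prefixSum (eval ψ w) i) ⟩
    g [] * prefixSum (indicator ∘ eval ψ w) i          ≡⟨ sumℤ-map-* (g []) _ (prefix i) ⟨
    prefixSum (λ j → g [] * indicator (eval ψ w j)) i  ≡⟨ prefixSum-cong (λ j → *-indicator (g []) (eval ψ w j)) i ⟩
    prefixSum (λ j → if eval ψ w j then g [] else 0ℤ) i ∎
    where open ≡-Reasoning
  guardedSum-expressible ψ (φ ∷ φs) g =
    let c₁ , eval-c₁ = guardedSum-expressible (ψ ∧' φ) φs (g ∘ (true ∷_))
        c₀ , eval-c₀ = guardedSum-expressible (ψ ∧' (¬' φ)) φs (g ∘ (false ∷_)) in
    c₁ +' c₀ , λ w i → begin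
      evalC c₁ w i + evalC c₀ w i
        ≡⟨ cong₂ _+_ (eval-c₁ w i) (eval-c₀ w i) ⟩
      prefixSum (λ j → if eval ψ w j ∧ eval φ w j then g (true ∷ truths φs w j) else 0ℤ) i
        + prefixSum (λ j → if eval ψ w j ∧ not (eval φ w j) then g (false ∷ truths φs w j) else 0ℤ) i
        ≡⟨ sumℤ-map-+ _ _ (prefix i) ⟨
      _ ≡⟨ prefixSum-cong (λ j → if-∧-split (eval ψ w j) (eval φ w j) (λ x → g (x ∷ truths φs w j))) i ⟩
      prefixSum (λ j → if eval ψ w j then g (truths (φ ∷ φs) w j) else 0ℤ) i ∎
    where open ≡-Reasoning

  prefixSum-expressible : {G : Fam ℤ} → Definable G → CountExpressible (λ w i → prefixSum (G w) i)
  prefixSum-expressible D =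
    let c , eval-c = guardedSum-expressible ⊤' (atoms D) (decode D) in
    c , λ w i → trans (eval-c w i) (prefixSum-cong (λ j → ≡.sym (decode-truths D w j)) i)

-- Transformer layers

module Layers (σ : ℕ) (b : Bool) (r s d : ℕ) where
  open Definability σ b

  V : Set
  V = Vec (FP r s) d

  ColumnFamily : Set
  ColumnFamily = ∀ {N} → Vec (Fin σ) N → Columns r s d (suc N)

  roundAtt-definable : {num den : Fam ℤ} → CountExpressible num → CountExpressible den →
                       Definable (λ w i → roundAtt {r} {s} (num w i) (den w i))
  roundAtt-definable {num} {den} NUM DEN = head-filterᵇ-definable (List.map fp (allFin _)) λ f →
    Definable-resp (λ w i → ≡.sym (isAttOut≡linearAttOut (num w i) (den w i) f)) (linearAttOut-definable f)
    where
      infixr 6 _∧ᵈ_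
      infixr 5 _∨ᵈ_
      _∧ᵈ_ = zipWith-definable _∧_
      _∨ᵈ_ = zipWith-definable _∨_
      linearAttOut-definable : ∀ f → Definable (λ w i → linearAttOut (num w i) (den w i) f)
      linearAttOut-definable f =
           (≤ᵇ-definable ONE DEN       ∧ᵈ ≤ᵇ-definable LO M ∧ᵈ ≤ᵇ-definable (+-expressible M ONE) HI)
        ∨ᵈ (≤ᵇ-definable DEN MINUS-ONE ∧ᵈ ≤ᵇ-definable M LO ∧ᵈ ≤ᵇ-definable (+-expressible HI ONE) M)
        where
          ONE       = const-expressible 1ℤ
          MINUS-ONE = const-expressible -1ℤ
          M  = *-expressible (+ (2 ^ s)) NUM
          LO = *-expressible (val f) DEN
          HI = *-expressible (val f + 1ℤ) DEN

  attend-definable : (ℓ : Layer r s d) (a : V) {Bs : Fam (List V)} →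
                     (∀ (h : V → ℤ) → CountExpressible (λ w i → sumℤ (List.map h (Bs w i)))) →
                     Definable (λ w i → attend ℓ a (Bs w i))
  attend-definable ℓ a sums = map-definable allJustVec (tabulate-definable λ k →
    roundAtt-definable (sums (λ v → val (mulF (expF (score a v)) (lookup (value v) k))))
                       (sums (λ v → val (expF (score a v)))))
    where open Layer ℓ

  columnUpdate : Layer r s d → List V → Maybe V → Maybe V
  columnUpdate ℓ bs c = c >>= λ a → attend ℓ a bs >>= λ sa → just (post₂ (post₁ a sa))
    where open Layer ℓ

  layerColumn : Layer r s d → List (Maybe V) → Maybe V → Maybe V
  layerColumn ℓ cs c = allJust cs >>= λ bs → columnUpdate ℓ bs c

  layerColumn-just : ∀ ℓ c₀ ms c → layerColumn ℓ (just c₀ ∷ ms) c ≡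
    (if any is-nothing ms then nothing else columnUpdate ℓ (c₀ ∷ List.map (fromMaybe c₀) ms) c)
  layerColumn-just ℓ c₀ ms c rewrite allJust-any c₀ ms with any is-nothing ms
  ... | true  = refl
  ... | false = refl

  columnUpdate-definable : (ℓ : Layer r s d) {Bs : Fam (List V)} →
                           (∀ (h : V → ℤ) → CountExpressible (λ w i → sumℤ (List.map h (Bs w i)))) →
                           {X : Fam (Maybe V)} → Definable X → Definable (λ w i → columnUpdate ℓ (Bs w i) (X w i))
  columnUpdate-definable ℓ {Bs} sums {X} DX =
    case-definable (Maybe-finite (Vec-finite FP-finite d)) {Y = λ c w i → columnUpdate ℓ (Bs w i) c} DX λ
    { nothing  → const-definable nothing
    ; (just a) → map-definable (_>>= λ sa → just (post₂ (post₁ a sa))) (attend-definable ℓ a {Bs} sums) }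
    where open Layer ℓ

  layerColumn-definable : (ℓ : Layer r s d) (c : Maybe V) {X : Fam (Maybe V)} → Definable X →
                          Definable (λ w i → layerColumn ℓ (c ∷ List.map (X w) (prefix i)) (X w i))
  layerColumn-definable ℓ nothing   DX = const-definable nothing
  layerColumn-definable ℓ (just c₀) {X} DX =
    Definable-resp (λ w i → ≡.sym (layerColumn-just ℓ c₀ (earlier w i) (X w i)))
      (if-definable undefined-definable (const-definable nothing) (columnUpdate-definable ℓ {attended} sums DX))
    where
      earlier : Fam (List (Maybe V))
      earlier w i = List.map (X w) (prefix i)
      attended : Fam (List V)
      attended w i = c₀ ∷ List.map (fromMaybe c₀) (earlier w i)
      undefined-definable : Definable (λ w i → any is-nothing (earlier w i))
      undefined-definable = Definable-resp
        (λ w i → ≡.sym (trans (any-≤ᵇ-sum is-nothing (earlier w i))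
                              (cong (1ℤ ≤ᵇ_) (sumℤ-map-∘ _ (X w) (prefix i)))))
        (≤ᵇ-definable (const-expressible 1ℤ) (prefixSum-expressible (map-definable (indicator ∘ is-nothing) DX)))
      sums : ∀ (h : V → ℤ) → CountExpressible (λ w i → sumℤ (List.map h (attended w i)))
      sums h = CountExpressible-resp
        (λ w i → cong (_+_ (h c₀)) (≡.sym (trans (sumℤ-map-∘ h (fromMaybe c₀) (earlier w i))
                                                 (sumℤ-map-∘ _ (X w) (prefix i)))))
        (+-expressible (const-expressible (h c₀)) (prefixSum-expressible (map-definable (h ∘ fromMaybe c₀) DX)))

  record DefinableColumns (A : ColumnFamily) : Set where
    field
      bos          : Maybe V
      bos-constant : ∀ {N} (w : Vec (Fin σ) N) → A w Fin.zero ≡ bos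
      letters      : Definable (λ w i → A w (Fin.suc i))

  applyLayer-definable : (ℓ : Layer r s d) {A : ColumnFamily} → DefinableColumns A →
                         DefinableColumns (λ w → applyLayer ℓ (A w))
  applyLayer-definable ℓ {A} DA = record
    { bos          = layerColumn ℓ (bos ∷ []) bos
    ; bos-constant = λ w → cong₂ (layerColumn ℓ)
        (trans (cong (List.map (A w)) prefix-zero) (cong (_∷ []) (bos-constant w))) (bos-constant w)
    ; letters      = Definable-resp (λ w i → ≡.sym (letterColumn w i)) (layerColumn-definable ℓ bos letters)
    }
    where
      open DefinableColumns DA
      letterColumn : ∀ {N} (w : Vec (Fin σ) N) i → applyLayer ℓ (A w) (Fin.suc i) ≡
                     layerColumn ℓ (bos ∷ List.map (A w ∘ Fin.suc) (prefix i)) (A w (Fin.suc i))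
      letterColumn w i = cong (λ cs → layerColumn ℓ cs (A w (Fin.suc i))) (begin
        List.map (A w) (prefix (Fin.suc i))
          ≡⟨ cong (List.map (A w)) (prefix-suc i) ⟩
        A w Fin.zero ∷ List.map (A w) (List.map Fin.suc (prefix i))
          ≡⟨ cong₂ _∷_ (bos-constant w) (≡.sym (ListP.map-∘ (prefix i))) ⟩
        bos ∷ List.map (A w ∘ Fin.suc) (prefix i) ∎)
        where open ≡-Reasoning

  runLayers-definable : (ℓs : List (Layer r s d)) {A : ColumnFamily} → DefinableColumns A →
                        DefinableColumns (λ w → runLayers ℓs (A w))
  runLayers-definable []       DA = DA
  runLayers-definable (ℓ ∷ ℓs) DA = runLayers-definable ℓs (applyLayer-definable ℓ DA)

  embedding-definable : (WE : Tok σ → V) → DefinableColumns (λ w j → just (WE (lookup (bosInput w) j)))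
  embedding-definable WE = record
    { bos          = just (WE BOS)
    ; bos-constant = λ _ → refl
    ; letters      = Definable-resp (λ w i → cong (just ∘ WE) (≡.sym (VecP.lookup-map i sym w)))
                                    (map-definable (Maybe.map (WE ∘ sym)) letter-definable)
    }

  entry-expressible : {A : ColumnFamily} → DefinableColumns A → (k : Fin d) (F : FP r s) →
    ∃ λ (Φ : Formula σ b) → (n : ℕ) (w : Vec (Fin σ) (suc n)) (i : Fin (suc n)) →
      (Maybe.map (λ col → lookup col k) (A w (Fin.suc i)) ≡ just F) ⇔ (w , i ⊨ Φ)
  entry-expressible DA k F =
    let Φ , Φ-level-set = level-set-expressible (MaybeP.≡-dec _≟FP_)
                            (map-definable (Maybe.map (λ col → lookup col k)) (DefinableColumns.letters DA)) (just F)
    in Φ , λ n w i → Φ-level-set w i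

-- Positional encodings

periodic-+* : ∀ (f : ℕ → A) p → (∀ c → f (p ℕ.+ c) ≡ f c) → ∀ k c → f (k ℕ.* p ℕ.+ c) ≡ f c
periodic-+* f p per zero    c = refl
periodic-+* f p per (suc k) c = trans (cong f (ℕP.+-assoc p (k ℕ.* p) c)) (trans (per _) (periodic-+* f p per k c))

periodic-% : ∀ (f : ℕ → A) p .{{_ : NonZero p}} → (∀ c → f (p ℕ.+ c) ≡ f c) → ∀ x → f (x % p) ≡ f x
periodic-% f p per x = begin
  f (x % p)                     ≡⟨ periodic-+* f p per (x ℕ./ p) (x % p) ⟨
  f (x ℕ./ p ℕ.* p ℕ.+ x % p)   ≡⟨ cong f (ℕP.+-comm (x ℕ./ p ℕ.* p) (x % p)) ⟩
  f (x % p ℕ.+ x ℕ./ p ℕ.* p)   ≡⟨ cong f (m≡m%n+[m/n]*n x p) ⟨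
  f x ∎
  where open ≡-Reasoning

residue-definable : ∀ {σ} p .{{_ : NonZero p}} → Definability.Definable σ true (λ w i → just (suc (toℕ i) mod p))
residue-definable {σ} (suc m) = partition-definable (MOD (suc m)) λ w i a →
  trans (isYes≗does _) (does-⇔ (mk⇔ (λ e → FinP.toℕ-injective (trans (FinP.toℕ-fromℕ< _) e))
                                    (λ e → trans (≡.sym (FinP.toℕ-fromℕ< _)) (cong toℕ e)))
                               (suc (toℕ i) % suc m ℕ.≟ toℕ a) (suc (toℕ i) mod suc m FinP.≟ a))
  where open Definability σ true

positionalEmbedding-definable : ∀ {σ r s d} (T : TransformerPE σ r s d) →
  Layers.DefinableColumns σ true r s d (λ w j → just (TransformerPE.addPE T
    (TransformerPE.WE T (lookup (bosInput w) j)) (TransformerPE.pe T (suc (toℕ j)))))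
positionalEmbedding-definable {σ} T = record
  { bos          = just (addPE (WE BOS) (pe 1))
  ; bos-constant = λ _ → refl
  ; letters      = Definable-resp
      (λ w i → cong₂ (λ t c → just (addPE (WE t) c)) (≡.sym (VecP.lookup-map i sym w)) (pe-residue (suc (toℕ i))))
      (zipWith-definable (Maybe.zipWith (λ a q → addPE (WE (sym a)) (pe (suc (toℕ q)))))
                         letter-definable (residue-definable period))
  }
  where
    open TransformerPE T
    open Definability σ true
    instance
      period-nonZero : NonZero period
      period-nonZero = ℕ.>-nonZero period≥1
    pe-residue : ∀ x → pe (suc (toℕ (x mod period))) ≡ pe (suc x)
    pe-residue x = trans (cong (pe ∘ suc) (FinP.toℕ-fromℕ< _))
      (periodic-% (pe ∘ suc) period (λ c → trans (cong pe (≡.sym (ℕP.+-suc period c))) (periodic (suc c))) x)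

theorem3 :
    ((σ r s d : ℕ) (T : Transformer σ r s d) (k : Fin d) (F : FP r s) →
       ∃ λ (Φ : Formula σ false) →
         (n : ℕ) (w : Vec (Fin σ) (suc n)) (i : Fin (suc n)) →
           (entry T w k i ≡ just F) ⇔ (w , i ⊨ Φ))
    ×
    ((σ r s d : ℕ) (T : TransformerPE σ r s d) (k : Fin d) (F : FP r s) →
       ∃ λ (Φ : Formula σ true) →
         (n : ℕ) (w : Vec (Fin σ) (suc n)) (i : Fin (suc n)) →
           (entryPE T w k i ≡ just F) ⇔ (w , i ⊨ Φ))
theorem3 =
  (λ σ r s d T k F → let open Layers σ false r s d in
     entry-expressible (runLayers-definable (Transformer.layers T) (embedding-definable (Transformer.WE T))) k F)
  ,
  (λ σ r s d T k F → let open Layers σ true r s d in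
     entry-expressible (runLayers-definable (TransformerPE.layers T) (positionalEmbedding-definable T)) k F)
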